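{- Let $G$ be a finite simple graph of order $n$ with independence number $\alpha(G)$. Then $\iota(\mathrm{Mid}(G))=\tau(G)\le n-\alpha(G)$.
   Context: For a graph $H$ and $S\subseteq V(H)$, let $N_H[S]$ be $S$ together with all vertices adjacent to a vertex of $S$. A set $S\subseteq V(H)$ is an isolating set of $H$ if $V(H)\setminus N_H[S]$ is an independent set of $H$; $\iota(H)$ is the minimum size of an isolating set of $H$. The middle graph $\mathrm{Mid}(G)$ has vertex set $V(G)\cup\{m_e: e\in E(G)\}$, with $v\sim m_e$ iff $v$ is an endpoint of $e$, $m_e\sim m_f$ iff distinct edges $e,f$ share an endpoint, and no edges between vertices of $V(G)$. For $E_0\subseteq E(G)$, $V(E_0)$ is the set of endpoints of edges in $E_0$; $\tau(G)$ is the minimum of $|E_0|$ over all $E_0\subseteq E(G)$ such that $V(G)\setminus V(E_0)$ is an independent set of $G$. -}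

module Defs where

open import Data.Bool using (Bool; true; false; T)
open import Data.Nat using (ℕ; _≤_)
open import Data.Fin using (Fin; _<_)
open import Data.Product using (Σ; ∃; _×_; _,_; proj₁; proj₂)
open import Data.Sum using (_⊎_; inj₁; inj₂)
open import Data.Empty using (⊥)
open import Data.List using (List; length)
open import Data.List.Membership.Propositional using (_∈_; _∉_)
open import Data.List.Relation.Unary.Unique.Propositional using (Unique)
open import Relation.Nullary using (¬_)
open import Relation.Binary.PropositionalEquality using (_≡_; _≢_)

record SimpleGraph (n : ℕ) : Set where
  field
    adj    : Fin n → Fin n → Bool
    sym    : ∀ i j → adj i j ≡ adj j i
    irrefl : ∀ i → adj i i ≡ false

open SimpleGraph public

Adj : ∀ {n} → SimpleGraph n → Fin n → Fin n → Set
Adj G i j = T (adj G i j)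

-- An edge {i,j} is represented uniquely as (i , j) with i < j.
Edge : ∀ {n} → SimpleGraph n → Set
Edge {n} G = Σ (Fin n) λ i → Σ (Fin n) λ j → (i < j) × Adj G i j

Endpoint : ∀ {n} {G : SimpleGraph n} → Fin n → Edge G → Set
Endpoint v (i , j , _) = (v ≡ i) ⊎ (v ≡ j)

record Graph : Set₁ where
  field
    V   : Set
    E   : V → V → Set

open Graph public

-- A finite set of vertices is a duplicate-free list; its size is its length.

InClosedNbhd : (H : Graph) → List (V H) → V H → Set
InClosedNbhd H S v = Σ (V H) λ s → (s ∈ S) × ((s ≡ v) ⊎ E H s v)

IsIsolating : (H : Graph) → List (V H) → Set
IsIsolating H S = ∀ u w → ¬ InClosedNbhd H S u → ¬ InClosedNbhd H S w → ¬ E H u w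

IsIsolationNumber : (H : Graph) → ℕ → Set
IsIsolationNumber H k =
  (Σ (List (V H)) λ S → Unique S × IsIsolating H S × length S ≡ k)
  × (∀ S → Unique S → IsIsolating H S → k ≤ length S)

MidAdj : ∀ {n} (G : SimpleGraph n) → Fin n ⊎ Edge G → Fin n ⊎ Edge G → Set
MidAdj G (inj₁ u) (inj₁ v) = ⊥
MidAdj G (inj₁ u) (inj₂ e) = Endpoint {G = G} u e
MidAdj G (inj₂ e) (inj₁ v) = Endpoint {G = G} v e
MidAdj G (inj₂ e) (inj₂ f) = (e ≢ f) × (Σ (Fin _) λ x → Endpoint {G = G} x e × Endpoint {G = G} x f)

Mid : ∀ {n} → SimpleGraph n → Graph
Mid {n} G = record { V = Fin n ⊎ Edge G ; E = MidAdj G }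

InVE : ∀ {n} {G : SimpleGraph n} → List (Edge G) → Fin n → Set
InVE {G = G} E₀ v = Σ (Edge G) λ e → (e ∈ E₀) × Endpoint {G = G} v e

IsTauSet : ∀ {n} (G : SimpleGraph n) → List (Edge G) → Set
IsTauSet G E₀ = ∀ u v → ¬ InVE {G = G} E₀ u → ¬ InVE {G = G} E₀ v → ¬ Adj G u v

IsTau : ∀ {n} (G : SimpleGraph n) → ℕ → Set
IsTau G k =
  (Σ (List (Edge G)) λ E₀ → Unique E₀ × IsTauSet G E₀ × length E₀ ≡ k)
  × (∀ E₀ → Unique E₀ → IsTauSet G E₀ → k ≤ length E₀)

IsIndependent : ∀ {n} (G : SimpleGraph n) → List (Fin n) → Set
IsIndependent G S = ∀ u v → u ∈ S → v ∈ S → ¬ Adj G u v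

IsIndependenceNumber : ∀ {n} (G : SimpleGraph n) → ℕ → Set
IsIndependenceNumber G a =
  (Σ (List (Fin _)) λ S → Unique S × IsIndependent G S × length S ≡ a)
  × (∀ S → Unique S → IsIndependent G S → length S ≤ a)

-- A list E₀ of edges is a τ-set exactly when no edge of G has both endpoints outside
-- V(E₀). In Mid(G) the edge-vertices of a τ-set are isolating: a vertex m_f outside
-- their closed neighbourhood would be an edge with no endpoint in V(E₀). Conversely,
-- keeping the edge-vertices of an isolating set S of Mid(G) and replacing each original
-- vertex by one incident edge gives a τ-set of at most |S| edges; hence ι(Mid G) = τ(G).
-- For an independent set I, one incident edge at each vertex outside I is already a
-- τ-set, so τ(G) ≤ n - |I|. Minima exist because every τ-set can be replaced by a
-- duplicate-free sublist, no longer than it, of the finite list of all edges.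
module Submission where

open import Defs
open import Data.Nat using (ℕ; _≤_; _∸_; _+_; z≤n; s≤s)
open import Data.Nat.Properties using (≤-trans; ≤-reflexive; +-mono-≤; ∸-monoˡ-≤; m+n∸m≡n; module ≤-Reasoning)
open import Data.Bool using (T)
open import Data.Bool.Properties using (T-irrelevant)
open import Data.Fin using (Fin; _<_; _<?_)
open import Data.Fin.Properties as Fin using (<-cmp; all?)
open import Data.Product using (Σ; _×_; _,_; proj₁; proj₂)
open import Data.Product.Properties using (≡-dec)
open import Data.Sum using (_⊎_; inj₁; inj₂; [_,_]′; swap)
open import Data.Sum.Properties using (inj₂-injective)
open import Data.Empty using (⊥-elim)
open import Data.List
  using (List; []; _∷_; [_]; _++_; length; map; filter; concatMap; deduplicate; allFin; cartesianProduct)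
open import Data.List.Properties using (length-++; length-map; length-tabulate; length-removeAt′)
open import Data.List.Relation.Unary.Any as Any using (here; there; any?; _─_)
open import Data.List.Relation.Unary.Any.Properties using (lookup-result)
import Data.List.Relation.Unary.All as All
open import Data.List.Relation.Unary.Unique.Propositional using (Unique; _∷_)
import Data.List.Relation.Unary.Unique.Propositional.Properties as Unique
open import Data.List.Relation.Unary.Unique.DecPropositional.Properties using (deduplicate-!)
open import Data.List.Relation.Binary.Subset.Propositional using (_⊆_)
open import Data.List.Membership.Propositional using (_∈_; _∉_; lose; find)
open import Data.List.Membership.Propositional.Properties
  using ( ∈-map⁺; ∈-map⁻; ∈-concatMap⁺; ∈-filter⁺; ∈-filter⁻; ∈-deduplicate⁺; ∈-deduplicate⁻
        ; ∈-++⁺ˡ; ∈-++⁺ʳ; ∈-allFin; ∈-cartesianProduct⁺)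
import Data.List.Membership.DecPropositional as DecMembership
import Data.List.Extrema.Nat as Extrema
open import Relation.Nullary using (¬_; Dec; yes; no)
open import Relation.Nullary.Decidable using (¬?; _×-dec_; _⊎-dec_; _→-dec_; T?; map′; decidable-stable)
open import Relation.Unary using (Decidable)
open import Function using (_∘_; id)
open import Relation.Binary using (DecidableEquality; tri<; tri≈; tri>)
open import Relation.Binary.PropositionalEquality using (_≡_; refl; cong; cong₂; subst; _≢_)
import Relation.Binary.PropositionalEquality as ≡

module _ {A : Set} where

  ∈-─ : ∀ {x y} {ys : List A} (x∈ys : x ∈ ys) → y ∈ ys → y ≢ x → y ∈ (ys ─ x∈ys)
  ∈-─ (here refl) (here refl) y≢x = ⊥-elim (y≢x refl)
  ∈-─ (here _)    (there y∈ys) _  = y∈ys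
  ∈-─ (there _)   (here refl)  _  = here refl
  ∈-─ (there x∈ys) (there y∈ys) y≢x = there (∈-─ x∈ys y∈ys y≢x)

  Unique-⊆⇒length≤ : ∀ {xs ys : List A} → Unique xs → xs ⊆ ys → length xs ≤ length ys
  Unique-⊆⇒length≤ {[]}     _             _  = z≤n
  Unique-⊆⇒length≤ {x ∷ xs} {ys} (x∉xs ∷ u) xs⊆ys =
    ≤-trans (s≤s (Unique-⊆⇒length≤ u xs⊆ys─x))
            (≤-reflexive (≡.sym (length-removeAt′ ys _)))
    where
    x∈ys = xs⊆ys (here refl)
    xs⊆ys─x : xs ⊆ (ys ─ x∈ys)
    xs⊆ys─x y∈xs = ∈-─ x∈ys (xs⊆ys (there y∈xs)) λ { refl → All.lookup x∉xs y∈xs refl }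

  concatMap-⊇ : ∀ {B : Set} (f : A → List B) {x xs} → x ∈ xs → f x ⊆ concatMap f xs
  concatMap-⊇ f x∈xs y∈fx = ∈-concatMap⁺ f (lose x∈xs y∈fx)

  length-concatMap≤ : ∀ {B : Set} (f : A → List B) → (∀ x → length (f x) ≤ 1) →
                      ∀ xs → length (concatMap f xs) ≤ length xs
  length-concatMap≤ f f≤1 []       = z≤n
  length-concatMap≤ f f≤1 (x ∷ xs) =
    ≤-trans (≤-reflexive (length-++ (f x))) (+-mono-≤ (f≤1 x) (length-concatMap≤ f f≤1 xs))

  sublists : List A → List (List A)
  sublists []       = [ [] ]
  sublists (x ∷ xs) = map (x ∷_) (sublists xs) ++ sublists xs

  filter∈sublists : ∀ {P : A → Set} (P? : Decidable P) xs → filter P? xs ∈ sublists xs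
  filter∈sublists P? []       = here refl
  filter∈sublists P? (x ∷ xs) with P? x
  ... | yes _ = ∈-++⁺ˡ (∈-map⁺ (x ∷_) (filter∈sublists P? xs))
  ... | no  _ = ∈-++⁺ʳ (map (x ∷_) (sublists xs)) (filter∈sublists P? xs)

module Minimisation {A : Set} (_≟_ : DecidableEquality A) {universe : List A}
                    (complete : ∀ x → x ∈ universe)
                    {P : List A → Set} (P? : Decidable P) (P-⊆ : ∀ {xs ys} → xs ⊆ ys → P xs → P ys)
                    where

  open DecMembership _≟_ using (_∈?_)
  open Extrema using (argmin; argmin-all; f[argmin]≤f[xs])

  normalise : List A → List A
  normalise xs = deduplicate _≟_ (filter (_∈? xs) universe)

  ⊆-normalise : ∀ xs → xs ⊆ normalise xs
  ⊆-normalise xs {x} x∈xs = ∈-deduplicate⁺ _≟_ (∈-filter⁺ (_∈? xs) (complete x) x∈xs)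

  normalise-⊆ : ∀ xs → normalise xs ⊆ xs
  normalise-⊆ xs x∈ =
    proj₂ (∈-filter⁻ (_∈? xs) {xs = universe} (∈-deduplicate⁻ _≟_ (filter (_∈? xs) universe) x∈))

  length-normalise : ∀ xs → length (normalise xs) ≤ length xs
  length-normalise xs = Unique-⊆⇒length≤ (deduplicate-! _≟_ _) (normalise-⊆ xs)

  candidates : List (List A)
  candidates = filter P? (map (deduplicate _≟_) (sublists universe))

  normalise∈candidates : ∀ {xs} → P xs → normalise xs ∈ candidates
  normalise∈candidates {xs} pxs =
    ∈-filter⁺ P? (∈-map⁺ (deduplicate _≟_) (filter∈sublists (_∈? xs) universe))
                 (P-⊆ (⊆-normalise xs) pxs)

  candidate-valid : ∀ {c} → c ∈ candidates → Unique c × P c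
  candidate-valid c∈ with ∈-filter⁻ P? {xs = map (deduplicate _≟_) (sublists universe)} c∈
  ... | c∈dedups , pc with ∈-map⁻ (deduplicate _≟_) {xs = sublists universe} c∈dedups
  ...   | ys , _ , refl = deduplicate-! _≟_ ys , pc

  minimum : ∀ {xs} → P xs → Σ (List A) λ m → Unique m × P m × (∀ ys → P ys → length m ≤ length ys)
  minimum {xs} pxs = m , proj₁ m-valid , proj₂ m-valid , m-least
    where
    m = argmin length (normalise xs) candidates

    m-valid : Unique m × P m
    m-valid = argmin-all length (deduplicate-! _≟_ _ , P-⊆ (⊆-normalise xs) pxs)
                                (All.tabulate candidate-valid)

    m-least : ∀ ys → P ys → length m ≤ length ys
    m-least ys pys = ≤-trans (All.lookup (f[argmin]≤f[xs] {f = length} (normalise xs) candidates)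
                                         (normalise∈candidates pys))
                             (length-normalise ys)

module _ {n : ℕ} (G : SimpleGraph n) where

  edge-irrelevant : ∀ {i j} (p q : (i < j) × Adj G i j) → p ≡ q
  edge-irrelevant (p , a) (q , b) = cong₂ _,_ (Fin.<-irrelevant p q) (T-irrelevant a b)

  _≟ᴱ_ : DecidableEquality (Edge G)
  _≟ᴱ_ = ≡-dec Fin._≟_ (≡-dec Fin._≟_ λ p q → yes (edge-irrelevant p q))

  edgesBetween : Fin n → Fin n → List (Edge G)
  edgesBetween i j with (i <? j) ×-dec T? (adj G i j)
  ... | yes p = [ (i , j , p) ]
  ... | no  _ = []

  edgesBetween-complete : ∀ (e : Edge G) → e ∈ edgesBetween (proj₁ e) (proj₁ (proj₂ e))
  edgesBetween-complete (i , j , p) with (i <? j) ×-dec T? (adj G i j)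
  ... | yes q = here (cong (λ r → i , j , r) (edge-irrelevant p q))
  ... | no ¬p = ⊥-elim (¬p p)

  allEdges : List (Edge G)
  allEdges = concatMap (λ (i , j) → edgesBetween i j) (cartesianProduct (allFin n) (allFin n))

  ∈-allEdges : ∀ e → e ∈ allEdges
  ∈-allEdges e@(i , j , _) =
    ∈-concatMap⁺ _ (lose (∈-cartesianProduct⁺ (∈-allFin i) (∈-allFin j)) (edgesBetween-complete e))

  edgeJoining : ∀ {u v} → Adj G u v → Σ (Edge G) λ e → ∀ x → Endpoint {G = G} x e → x ≡ u ⊎ x ≡ v
  edgeJoining {u} {v} a with <-cmp u v
  ... | tri< u<v _ _ = (u , v , u<v , a) , λ _ x∈e → x∈e
  ... | tri≈ _ refl _ = ⊥-elim (subst T (irrefl G u) a)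
  ... | tri> _ _ v<u = (v , u , v<u , subst T (SimpleGraph.sym G u v) a) , λ _ x∈e → swap x∈e

  endpoint? : ∀ x (e : Edge G) → Dec (Endpoint {G = G} x e)
  endpoint? x (i , j , _) = (x Fin.≟ i) ⊎-dec (x Fin.≟ j)

  InVE? : ∀ E₀ x → Dec (InVE {G = G} E₀ x)
  InVE? E₀ x = map′ find (λ (e , e∈E₀ , x∈e) → lose e∈E₀ x∈e) (any? (endpoint? x) E₀)

  InVE-mono : ∀ {E₀ E₁} → E₀ ⊆ E₁ → ∀ {x} → InVE {G = G} E₀ x → InVE {G = G} E₁ x
  InVE-mono E₀⊆E₁ (e , e∈E₀ , x∈e) = e , E₀⊆E₁ e∈E₀ , x∈e

  IsTauSet? : Decidable (IsTauSet G)
  IsTauSet? E₀ = all? λ u → all? λ v →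
    ¬? (InVE? E₀ u) →-dec ¬? (InVE? E₀ v) →-dec ¬? (T? (adj G u v))

  IsTauSet-mono : ∀ {E₀ E₁} → E₀ ⊆ E₁ → IsTauSet G E₀ → IsTauSet G E₁
  IsTauSet-mono E₀⊆E₁ t u v u∉ v∉ = t u v (u∉ ∘ InVE-mono E₀⊆E₁) (v∉ ∘ InVE-mono E₀⊆E₁)

  Uncovered : List (Edge G) → Edge G → Set
  Uncovered E₀ e = ∀ x → Endpoint {G = G} x e → ¬ InVE {G = G} E₀ x

  IsTauSet⇒¬Uncovered : ∀ {E₀} → IsTauSet G E₀ → ∀ e → ¬ Uncovered E₀ e
  IsTauSet⇒¬Uncovered t (i , j , _ , a) unc = t i j (unc i (inj₁ refl)) (unc j (inj₂ refl)) a

  ¬Uncovered⇒IsTauSet : ∀ {E₀} → (∀ e → ¬ Uncovered E₀ e) → IsTauSet G E₀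
  ¬Uncovered⇒IsTauSet covered u v u∉ v∉ a with edgeJoining a
  ... | e , ends = covered e λ x x∈e → [ (λ { refl → u∉ }) , (λ { refl → v∉ }) ]′ (ends x x∈e)

  edgeAt : Fin n → List (Edge G)
  edgeAt x with any? (endpoint? x) allEdges
  ... | yes p = [ Any.lookup p ]
  ... | no  _ = []

  length-edgeAt : ∀ x → length (edgeAt x) ≤ 1
  length-edgeAt x with any? (endpoint? x) allEdges
  ... | yes _ = s≤s z≤n
  ... | no  _ = z≤n

  edgeAt-covers : ∀ {x} e → Endpoint {G = G} x e → InVE {G = G} (edgeAt x) x
  edgeAt-covers {x} e x∈e with any? (endpoint? x) allEdges
  ... | yes p = Any.lookup p , here refl , lookup-result p
  ... | no ¬p = ⊥-elim (¬p (lose (∈-allEdges e) x∈e))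

  outsideClosedNbhd⇒Uncovered : ∀ {E₀} f → ¬ InClosedNbhd (Mid G) (map inj₂ E₀) (inj₂ f) →
                                Uncovered E₀ f
  outsideClosedNbhd⇒Uncovered f f∉ x x∈f (e , e∈E₀ , x∈e) with e ≟ᴱ f
  ... | yes e≡f = f∉ (inj₂ e , ∈-map⁺ inj₂ e∈E₀ , inj₁ (cong inj₂ e≡f))
  ... | no  e≢f = f∉ (inj₂ e , ∈-map⁺ inj₂ e∈E₀ , inj₂ (e≢f , x , x∈e , x∈f))

  IsTauSet⇒IsIsolating : ∀ {E₀} → IsTauSet G E₀ → IsIsolating (Mid G) (map inj₂ E₀)
  IsTauSet⇒IsIsolating t (inj₁ _) (inj₁ _) _  _  ()
  IsTauSet⇒IsIsolating t (inj₁ _) (inj₂ f) _  f∉ _ = IsTauSet⇒¬Uncovered t f (outsideClosedNbhd⇒Uncovered f f∉)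
  IsTauSet⇒IsIsolating t (inj₂ f) _        f∉ _  _ = IsTauSet⇒¬Uncovered t f (outsideClosedNbhd⇒Uncovered f f∉)

  edgesFor : Fin n ⊎ Edge G → List (Edge G)
  edgesFor (inj₁ x) = edgeAt x
  edgesFor (inj₂ e) = [ e ]

  length-edgesFor : ∀ s → length (edgesFor s) ≤ 1
  length-edgesFor (inj₁ x) = length-edgeAt x
  length-edgesFor (inj₂ e) = s≤s z≤n

  module _ (S : List (Fin n ⊎ Edge G)) where

    covered-by-vertex : ∀ {x : Fin n} (e : Edge G) → inj₁ x ∈ S → Endpoint {G = G} x e →
                        InVE {G = G} (concatMap edgesFor S) x
    covered-by-vertex e x∈S x∈e = InVE-mono (concatMap-⊇ edgesFor x∈S) (edgeAt-covers e x∈e)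

    covered-by-edge : ∀ {x : Fin n} {e : Edge G} → inj₂ e ∈ S → Endpoint {G = G} x e →
                      InVE {G = G} (concatMap edgesFor S) x
    covered-by-edge {e = e} e∈S x∈e = e , concatMap-⊇ edgesFor e∈S (here refl) , x∈e

    IsIsolating⇒IsTauSet : IsIsolating (Mid G) S → IsTauSet G (concatMap edgesFor S)
    -- An uncovered edge f and its first endpoint would be adjacent in Mid(G) and both outside N[S].
    IsIsolating⇒IsTauSet iso = ¬Uncovered⇒IsTauSet λ f unc →
      iso (inj₁ (proj₁ f)) (inj₂ f) (endpoint∉ f unc) (edge∉ f unc) (inj₁ refl)
      where
      endpoint∉ : ∀ f → Uncovered (concatMap edgesFor S) f → ¬ InClosedNbhd (Mid G) S (inj₁ (proj₁ f))
      endpoint∉ f@(i , _) unc (inj₁ _ , i∈S , inj₁ refl) = unc i (inj₁ refl) (covered-by-vertex f i∈S (inj₁ refl))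
      endpoint∉ (i , _)   unc (inj₂ _ , e∈S , inj₂ i∈e)  = unc i (inj₁ refl) (covered-by-edge e∈S i∈e)

      edge∉ : ∀ f → Uncovered (concatMap edgesFor S) f → ¬ InClosedNbhd (Mid G) S (inj₂ f)
      edge∉ f       unc (inj₁ x , x∈S , inj₂ x∈f)                 = unc x x∈f (covered-by-vertex f x∈S x∈f)
      edge∉ (i , _) unc (inj₂ _ , f∈S , inj₁ refl)                = unc i (inj₁ refl) (covered-by-edge f∈S (inj₁ refl))
      edge∉ f       unc (inj₂ _ , e∈S , inj₂ (_ , x , x∈e , x∈f)) = unc x x∈f (covered-by-edge e∈S x∈e)

  module _ (I : List (Fin n)) where

    open DecMembership (Fin._≟_ {n}) using (_∈?_)

    _∉I? : Decidable (_∉ I)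
    x ∉I? = ¬? (x ∈? I)

    outside : List (Fin n)
    outside = filter _∉I? (allFin n)

    IsIndependent⇒IsTauSet : IsIndependent G I → IsTauSet G (concatMap edgeAt outside)
    IsIndependent⇒IsTauSet ind = ¬Uncovered⇒IsTauSet λ { e@(i , j , _ , a) unc →
        ind i j (∈I {e} unc (inj₁ refl)) (∈I {e} unc (inj₂ refl)) a }
      where
      ∈I : ∀ {e : Edge G} {x} → Uncovered (concatMap edgeAt outside) e → Endpoint {G = G} x e → x ∈ I
      ∈I {e} {x} unc x∈e = decidable-stable (x ∈? I) λ x∉I →
        unc x x∈e (InVE-mono (concatMap-⊇ edgeAt (∈-filter⁺ _∉I? (∈-allFin x) x∉I))
                             (edgeAt-covers e x∈e))

    length-outside : Unique I → length outside ≤ n ∸ length I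
    length-outside uI = subst (_≤ n ∸ length I) (m+n∸m≡n (length I) (length outside))
                              (∸-monoˡ-≤ (length I) I+outside≤n)
      where
      I+outside≤n : length I + length outside ≤ n
      I+outside≤n = begin
        length I + length outside  ≡⟨ length-++ I ⟨
        length (I ++ outside)      ≤⟨ Unique-⊆⇒length≤ unique-I++outside (λ {x} _ → ∈-allFin x) ⟩
        length (allFin n)          ≡⟨ length-tabulate id ⟩
        n                          ∎
        where
        open ≤-Reasoning

        disjoint : ∀ {x} → ¬ (x ∈ I × x ∈ outside)
        disjoint (x∈I , x∈outside) = proj₂ (∈-filter⁻ _∉I? {xs = allFin n} x∈outside) x∈I

        unique-I++outside : Unique (I ++ outside)
        unique-I++outside = Unique.++⁺ uI (Unique.filter⁺ _∉I? (Unique.allFin⁺ n)) disjoint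

    length-edgesAt-outside : Unique I → length (concatMap edgeAt outside) ≤ n ∸ length I
    length-edgesAt-outside uI = ≤-trans (length-concatMap≤ edgeAt length-edgeAt outside) (length-outside uI)

  open Minimisation _≟ᴱ_ ∈-allEdges IsTauSet? IsTauSet-mono using (minimum)

  isolationNumber-Mid≡tau : ∀ {E₀} → IsTauSet G E₀ →
                            Σ ℕ λ k → IsIsolationNumber (Mid G) k × IsTau G k × k ≤ length E₀
  isolationNumber-Mid≡tau {E₀} t with minimum t
  ... | m , unique , m-tau , least =
      length m
    , ( (map inj₂ m , Unique.map⁺ inj₂-injective unique , IsTauSet⇒IsIsolating m-tau , length-map inj₂ m)
      , λ S _ iso → ≤-trans (least _ (IsIsolating⇒IsTauSet S iso))
                            (length-concatMap≤ edgesFor length-edgesFor S) )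
    , ((m , unique , m-tau , refl) , λ E₁ _ → least E₁)
    , least E₀ t

proposition7 : (n : ℕ) (G : SimpleGraph n) (a : ℕ) → IsIndependenceNumber G a →
    Σ ℕ (λ k → IsIsolationNumber (Mid G) k × IsTau G k × k ≤ n ∸ a)
proposition7 n G _ ((I , unique , independent , refl) , _)
  with isolationNumber-Mid≡tau G (IsIndependent⇒IsTauSet G I independent)
... | k , ι≡k , τ≡k , k≤ = k , ι≡k , τ≡k , ≤-trans k≤ (length-edgesAt-outside G I unique)
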